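{- Let $M$ be a loopless hypermodular matroid of rank at least $3$, and let $F$ and $L$ be two distinct corank-$1$ flats of $M$. Then either $F\cup L$ is a proper subset of $E(M)$, or $F\cup L=E(M)$ and one of $F,L$ is a union of two corank-$2$ flats of $M$, where the intersection of these two corank-$2$ flats is nonempty if $r(M)\ge4$.
   Context: A flat of corank $c$ is a flat of rank $r(M)-c$. A pair of flats $\{A,B\}$ is modular if $r(A\cup B)+r(A\cap B)=r(A)+r(B)$. A matroid of rank $k\ge3$ is hypermodular if every pair of two corank-$1$ flats is a modular pair. -}

module Defs where

open import Data.Nat using (ℕ; _≤_; _<_; _+_)
open import Data.Fin using (Fin)
open import Data.Product using (_×_)
open import Relation.Binary.PropositionalEquality using (_≡_)
open import Data.Fin.Subset using (Subset; _∪_; _∩_; _⊆_; _∉_; ⁅_⁆; ∣_∣; ⊤)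

record Matroid (n : ℕ) : Set where
  field
    r        : Subset n → ℕ
    r-bound  : ∀ X → r X ≤ ∣ X ∣
    r-mono   : ∀ {X Y} → X ⊆ Y → r X ≤ r Y
    r-submod : ∀ X Y → r (X ∪ Y) + r (X ∩ Y) ≤ r X + r Y

module _ {n : ℕ} (M : Matroid n) where
  open Matroid M

  rankM : ℕ
  rankM = r ⊤

  IsFlat : Subset n → Set
  IsFlat X = ∀ e → e ∉ X → r X < r (X ∪ ⁅ e ⁆)

  IsCorankFlat : ℕ → Subset n → Set
  IsCorankFlat c X = IsFlat X × (r X + c ≡ rankM)

  Loopless : Set
  Loopless = ∀ e → r ⁅ e ⁆ ≡ 1

  ModularPair : Subset n → Subset n → Set
  ModularPair A B = r (A ∪ B) + r (A ∩ B) ≡ r A + r B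

  Hypermodular : Set
  Hypermodular = (3 ≤ rankM) ×
    (∀ A B → IsCorankFlat 1 A → IsCorankFlat 1 B → ModularPair A B)

-- Hypermodularity makes any two distinct hyperplanes meet in a corank-2 flat. Suppose
-- F ∪ L = E, fix a corank-3 flat Z ⊆ F ∩ L and write Z ∨ a for the corank-2 flat cl(Z ∪ {a}).
-- For a ∈ F ∖ L and b ∈ L ∖ F the hyperplane (Z ∨ a) ∨ b meets F in Z ∨ a and L in Z ∨ b.
-- Two distinct such hyperplanes meet in a corank-2 flat, so in a point outside Z; that point
-- lies in F or in L and forces Z ∨ a₀ = Z ∨ a₁ or Z ∨ b₀ = Z ∨ b₁. Hence F ∖ L ⊆ Z ∨ a₀ or
-- L ∖ F ⊆ Z ∨ b₀, i.e. F = (F ∩ L) ∪ (Z ∨ a₀) or L = (L ∩ F) ∪ (Z ∨ b₀); both pieces contain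
-- Z, which has positive rank once r(M) ≥ 4.
module Submission where

open import Defs
open import Algebra.Properties.CommutativeSemigroup using (interchange)
open import Data.Bool using (true; false)
open import Data.Empty using (⊥-elim)
open import Data.Fin using (Fin; _≟_)
open import Data.Fin.Properties using (any?)
open import Data.Fin.Subset using (Subset; _∪_; _∩_; _⊂_; _⊆_; _∈_; _∉_; ⁅_⁆; ⊤; ⊥; _-_; Nonempty)
open import Data.Fin.Subset.Properties
open import Data.Fin.Subset.Induction using (⊂-wellFounded; Acc; acc)
open import Data.Nat using (ℕ; zero; suc; _+_; _∸_; _≤_; _<_; _≤?_)
open import Data.Nat.Properties hiding (_≟_)
open import Data.Product using (Σ; ∃; _×_; _,_; proj₁; proj₂)
open import Data.Sum using (_⊎_; inj₁; inj₂)
open import Data.Vec using (tabulate; lookup)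
open import Data.Vec.Properties using (lookup∘tabulate; []=⇒lookup; lookup⇒[]=)
open import Function using (_∘_)
open import Relation.Nullary using (Dec; yes; no; does; ¬_; ¬?)
open import Relation.Nullary.Decidable using (dec-true; dec-false; decidable-stable; _×-dec_)
open import Relation.Binary.PropositionalEquality
  using (_≡_; _≢_; refl; sym; trans; cong; cong₂; subst; module ≡-Reasoning)

private
  variable
    n : ℕ
    a b e a₀ b₀ : Fin n
    A B C D G H S X Y Z : Subset n
    c d : ℕ

infix 4 _∈_∖_

_∈_∖_ : Fin n → Subset n → Subset n → Set
x ∈ A ∖ B = x ∈ A × x ∉ B

⊆-or-∃∉ : (A B : Subset n) → A ⊆ B ⊎ ∃ λ e → e ∈ A ∖ B
⊆-or-∃∉ A B with any? (λ e → (e ∈? A) ×-dec ¬? (e ∈? B))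
... | yes witness = inj₂ witness
... | no none = inj₁ λ {e} e∈A → decidable-stable (e ∈? B) (λ e∉B → none (e , e∈A , e∉B))

∪-least : A ⊆ C → B ⊆ C → A ∪ B ⊆ C
∪-least {A = A} {B = B} A⊆C B⊆C x∈A∪B with x∈p∪q⁻ A B x∈A∪B
... | inj₁ x∈A = A⊆C x∈A
... | inj₂ x∈B = B⊆C x∈B

∩-greatest : C ⊆ A → C ⊆ B → C ⊆ A ∩ B
∩-greatest C⊆A C⊆B x∈C = x∈p∩q⁺ (C⊆A x∈C , C⊆B x∈C)

⁅⁆-⊆ : e ∈ A → ⁅ e ⁆ ⊆ A
⁅⁆-⊆ {e = e} {A = A} e∈A x∈⁅e⁆ = subst (_∈ A) (sym (x∈⁅y⁆⇒x≡y e x∈⁅e⁆)) e∈A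

∪-monoˡ-⊆ : A ⊆ B → A ∪ C ⊆ B ∪ C
∪-monoˡ-⊆ {B = B} {C = C} A⊆B = ∪-least (p⊆p∪q C ∘ A⊆B) (q⊆p∪q B C)

⊆-∪⇒≡-∩-∪ : G ⊆ H ∪ C → C ⊆ G → G ≡ (G ∩ H) ∪ C
⊆-∪⇒≡-∩-∪ {G = G} {H = H} {C = C} G⊆H∪C C⊆G =
  ⊆-antisym G⊆ (∪-least (p∩q⊆p G H) C⊆G)
  where
  G⊆ : G ⊆ (G ∩ H) ∪ C
  G⊆ x∈G with x∈p∪q⁻ H C (G⊆H∪C x∈G)
  ... | inj₁ x∈H = p⊆p∪q C (x∈p∩q⁺ (x∈G , x∈H))
  ... | inj₂ x∈C = q⊆p∪q (G ∩ H) C x∈C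

modular-corank : ∀ {g h x k} a b → g + a ≡ k → h + b ≡ k → k + x ≡ g + h → x + (a + b) ≡ k
modular-corank {g} {h} {x} {k} a b g+a≡k h+b≡k modular = +-cancelˡ-≡ k _ _ (begin
  k + (x + (a + b)) ≡⟨ +-assoc k x (a + b) ⟨
  (k + x) + (a + b) ≡⟨ cong (_+ (a + b)) modular ⟩
  (g + h) + (a + b) ≡⟨ interchange +-commutativeSemigroup g h a b ⟩
  (g + a) + (h + b) ≡⟨ cong₂ _+_ g+a≡k h+b≡k ⟩
  k + k             ∎)
  where open ≡-Reasoning

module MatroidFlats (M : Matroid n) where
  open Matroid M

  Spans : Subset n → Fin n → Set
  Spans S e = r (S ∪ ⁅ e ⁆) ≤ r S

  r-submod-⊆ : C ⊆ A ∪ B → D ⊆ A ∩ B → r C + r D ≤ r A + r B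
  r-submod-⊆ {A = A} {B = B} C⊆A∪B D⊆A∩B =
    ≤-trans (+-mono-≤ (r-mono C⊆A∪B) (r-mono D⊆A∩B)) (r-submod A B)

  r-⊥ : r ⊥ ≡ 0
  r-⊥ = n≤0⇒n≡0 (subst (r ⊥ ≤_) (∣⊥∣≡0 n) (r-bound ⊥))

  positive-rank⇒Nonempty : 0 < r X → Nonempty X
  positive-rank⇒Nonempty {X = X} 0<rX with nonempty? X
  ... | yes nonempty = nonempty
  ... | no empty = ⊥-elim (<⇒≢ 0<rX (sym (trans (cong r (Empty-unique empty)) r-⊥)))

  r-∪⁅⁆-≤ : ∀ S e → r (S ∪ ⁅ e ⁆) ≤ suc (r S)
  r-∪⁅⁆-≤ S e = begin
    r (S ∪ ⁅ e ⁆)                     ≤⟨ m≤m+n _ _ ⟩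
    r (S ∪ ⁅ e ⁆) + r (S ∩ ⁅ e ⁆)     ≤⟨ r-submod S ⁅ e ⁆ ⟩
    r S + r ⁅ e ⁆                     ≤⟨ +-monoʳ-≤ (r S) (subst (r ⁅ e ⁆ ≤_) (∣⁅x⁆∣≡1 e) (r-bound ⁅ e ⁆)) ⟩
    r S + 1                           ≡⟨ +-comm (r S) 1 ⟩
    suc (r S)                         ∎
    where open ≤-Reasoning

  r-∪⁅⁆≡suc : r S < r (S ∪ ⁅ e ⁆) → r (S ∪ ⁅ e ⁆) ≡ suc (r S)
  r-∪⁅⁆≡suc {S = S} {e = e} = ≤-antisym (r-∪⁅⁆-≤ S e)

  spans-mono : S ⊆ X → Spans S e → Spans X e
  spans-mono {S = S} {X = X} {e = e} S⊆X S-spans =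
    +-cancelʳ-≤ (r S) _ _ (begin
      r (X ∪ ⁅ e ⁆) + r S   ≤⟨ r-submod-⊆ (∪-least (p⊆p∪q _) (q⊆p∪q X _ ∘ q⊆p∪q S ⁅ e ⁆))
                                           (∩-greatest S⊆X (p⊆p∪q ⁅ e ⁆)) ⟩
      r X + r (S ∪ ⁅ e ⁆)   ≤⟨ +-monoʳ-≤ (r X) S-spans ⟩
      r X + r S             ∎)
    where open ≤-Reasoning

  flat-spans⇒∈ : IsFlat M X → Spans X e → e ∈ X
  flat-spans⇒∈ {X = X} {e = e} X-flat X-spans =
    decidable-stable (e ∈? X) (λ e∉X → <⇒≱ (X-flat e e∉X) X-spans)

  -- Remove one t ∈ U at a time, using submodularity for S ∪ (U - t) and S ∪ ⁅ t ⁆, which meet in ⊇ S.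
  r-∪-spanned : ∀ S U → (∀ {t} → t ∈ U → Spans S t) → r (S ∪ U) ≤ r S
  r-∪-spanned S U = go U (⊂-wellFounded U)
    where
    go : ∀ U → Acc _⊂_ U → (∀ {t} → t ∈ U → Spans S t) → r (S ∪ U) ≤ r S
    go U (acc rec) spanned with nonempty? U
    ... | no empty =
      ≤-reflexive (cong r (trans (cong (S ∪_) (Empty-unique empty)) (∪-identityʳ S)))
    ... | yes (t , t∈U) = +-cancelʳ-≤ (r S) _ _ (begin
        r (S ∪ U) + r S                          ≤⟨ r-submod-⊆ cover (∩-greatest (p⊆p∪q _) (p⊆p∪q _)) ⟩
        r (S ∪ (U - t)) + r (S ∪ ⁅ t ⁆)          ≤⟨ +-mono-≤ (go (U - t) (rec (x∈p⇒p-x⊂p t∈U)) (spanned ∘ p─q⊆p U ⁅ t ⁆))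
                                                             (spanned t∈U) ⟩
        r S + r S                                ∎)
      where
      open ≤-Reasoning
      cover : S ∪ U ⊆ (S ∪ (U - t)) ∪ (S ∪ ⁅ t ⁆)
      cover {x} x∈S∪U with x∈p∪q⁻ S U x∈S∪U | x ≟ t
      ... | inj₁ x∈S | _       = p⊆p∪q _ (p⊆p∪q _ x∈S)
      ... | inj₂ _   | yes refl = q⊆p∪q _ _ (q⊆p∪q S _ (x∈⁅x⁆ t))
      ... | inj₂ x∈U | no x≢t  = p⊆p∪q _ (q⊆p∪q S _ (x∈p∧x≢y⇒x∈p-y x∈U x≢t))

  spans? : ∀ S e → Dec (Spans S e)
  spans? S e = r (S ∪ ⁅ e ⁆) ≤? r S

  cl : Subset n → Subset n
  cl S = tabulate (does ∘ spans? S)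

  ∈-cl⁺ : Spans S e → e ∈ cl S
  ∈-cl⁺ {S = S} {e = e} S-spans = lookup⇒[]= e (cl S)
    (trans (lookup∘tabulate (does ∘ spans? S) e) (dec-true (spans? S e) S-spans))

  ∈-cl⁻ : e ∈ cl S → Spans S e
  ∈-cl⁻ {e = e} {S = S} e∈clS = decidable-stable (spans? S e) λ ¬spans → false≢true (begin
    false                            ≡⟨ dec-false (spans? S e) ¬spans ⟨
    does (spans? S e)                ≡⟨ lookup∘tabulate (does ∘ spans? S) e ⟨
    lookup (cl S) e                 ≡⟨ []=⇒lookup e∈clS ⟩
    true                             ∎)
    where
    open ≡-Reasoning
    false≢true : false ≢ true
    false≢true ()

  ⊆-cl : S ⊆ cl S
  ⊆-cl e∈S = ∈-cl⁺ (r-mono (∪-least ⊆-refl (⁅⁆-⊆ e∈S)))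

  r-cl : ∀ S → r (cl S) ≡ r S
  r-cl S = ≤-antisym (≤-trans (r-mono (q⊆p∪q S (cl S))) (r-∪-spanned S (cl S) ∈-cl⁻))
                     (r-mono ⊆-cl)

  cl-isFlat : ∀ S → IsFlat M (cl S)
  cl-isFlat S e e∉clS = ≰⇒> λ clS-spans → e∉clS (∈-cl⁺ (begin
    r (S ∪ ⁅ e ⁆)      ≤⟨ r-mono (∪-monoˡ-⊆ ⊆-cl) ⟩
    r (cl S ∪ ⁅ e ⁆)   ≤⟨ clS-spans ⟩
    r (cl S)           ≡⟨ r-cl S ⟩
    r S                ∎))
    where open ≤-Reasoning

  cl-least : S ⊆ X → IsFlat M X → cl S ⊆ X
  cl-least S⊆X X-flat e∈clS = flat-spans⇒∈ X-flat (spans-mono S⊆X (∈-cl⁻ e∈clS))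

  ∩-isFlat : IsFlat M A → IsFlat M B → IsFlat M (A ∩ B)
  ∩-isFlat {A = A} {B = B} A-flat B-flat e e∉A∩B = ≰⇒> λ A∩B-spans → e∉A∩B (x∈p∩q⁺
    ( flat-spans⇒∈ A-flat (spans-mono (p∩q⊆p A B) A∩B-spans)
    , flat-spans⇒∈ B-flat (spans-mono (p∩q⊆q A B) A∩B-spans)))

  flat-⊆⇒≡ : IsFlat M X → X ⊆ Y → r Y ≤ r X → X ≡ Y
  flat-⊆⇒≡ X-flat X⊆Y rY≤rX = ⊆-antisym X⊆Y λ e∈Y →
    flat-spans⇒∈ X-flat (≤-trans (r-mono (∪-least X⊆Y (⁅⁆-⊆ e∈Y))) rY≤rX)

  ∃-⊆-of-rank : ∀ X m → m ≤ r X → Σ (Subset n) λ S → S ⊆ X × r S ≡ m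
  ∃-⊆-of-rank X zero _ = ⊥ , ⊆-min X , r-⊥
  ∃-⊆-of-rank X (suc m) m<rX with ∃-⊆-of-rank X m (<⇒≤ m<rX)
  ... | S , S⊆X , rS≡m with ⊆-or-∃∉ X (cl S)
  ... | inj₁ X⊆clS = ⊥-elim (<⇒≱ m<rX (begin
    r X       ≤⟨ r-mono X⊆clS ⟩
    r (cl S)  ≡⟨ r-cl S ⟩
    r S       ≡⟨ rS≡m ⟩
    m         ∎))
    where open ≤-Reasoning
  ... | inj₂ (e , e∈X , e∉clS) =
    S ∪ ⁅ e ⁆ , ∪-least S⊆X (⁅⁆-⊆ e∈X) ,
    trans (r-∪⁅⁆≡suc (≰⇒> (e∉clS ∘ ∈-cl⁺))) (cong suc rS≡m)

  corankFlat-⊆⇒≡ : IsCorankFlat M c X → IsCorankFlat M c Y → X ⊆ Y → X ≡ Y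
  corankFlat-⊆⇒≡ {c = c} {X = X} {Y = Y} (X-flat , rX+c≡k) (_ , rY+c≡k) X⊆Y =
    flat-⊆⇒≡ X-flat X⊆Y (≤-reflexive (+-cancelʳ-≡ c (r Y) (r X) (trans rY+c≡k (sym rX+c≡k))))

  corankFlat-⊆⇒≤ : IsCorankFlat M c X → IsCorankFlat M d Y → X ⊆ Y → d ≤ c
  corankFlat-⊆⇒≤ {c = c} {X = X} {d = d} {Y = Y} (_ , rX+c≡k) (_ , rY+d≡k) X⊆Y =
    +-cancelˡ-≤ (r X) d c (begin
      r X + d   ≤⟨ +-monoˡ-≤ d (r-mono X⊆Y) ⟩
      r Y + d   ≡⟨ trans rY+d≡k (sym rX+c≡k) ⟩
      r X + c   ∎)
    where open ≤-Reasoning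

  corankFlat-≢⇒∃∉ : IsCorankFlat M c G → IsCorankFlat M c H → G ≢ H → ∃ λ e → e ∈ H ∖ G
  corankFlat-≢⇒∃∉ {G = G} {H = H} cG cH G≢H with ⊆-or-∃∉ H G
  ... | inj₁ H⊆G = ⊥-elim (G≢H (sym (corankFlat-⊆⇒≡ cH cG H⊆G)))
  ... | inj₂ witness = witness

  corankFlat-Nonempty : IsCorankFlat M c X → suc c ≤ rankM M → Nonempty X
  corankFlat-Nonempty {c = c} {X = X} (_ , rX+c≡k) 1+c≤k =
    positive-rank⇒Nonempty (+-cancelʳ-≤ c 1 (r X) (subst (suc c ≤_) (sym rX+c≡k) 1+c≤k))

  ∃-corankFlat-⊆ : IsCorankFlat M c X → c ≤ d → d ≤ rankM M →
                   Σ (Subset n) λ Z → IsCorankFlat M d Z × Z ⊆ X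
  ∃-corankFlat-⊆ {c = c} {X = X} {d = d} (X-flat , rX+c≡k) c≤d d≤k
    with ∃-⊆-of-rank X (rankM M ∸ d) (begin
      rankM M ∸ d   ≤⟨ ∸-monoʳ-≤ (rankM M) c≤d ⟩
      rankM M ∸ c   ≡⟨ cong (_∸ c) rX+c≡k ⟨
      r X + c ∸ c   ≡⟨ m+n∸n≡m (r X) c ⟩
      r X           ∎)
    where open ≤-Reasoning
  ... | S , S⊆X , rS≡k∸d =
    cl S , (cl-isFlat S , trans (cong (_+ d) (trans (r-cl S) rS≡k∸d)) (m∸n+n≡m d≤k)) ,
    cl-least S⊆X X-flat

  infixl 6 _∨_

  _∨_ : Subset n → Fin n → Subset n
  X ∨ e = cl (X ∪ ⁅ e ⁆)

  ⊆-∨ : X ⊆ X ∨ e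
  ⊆-∨ = ⊆-cl ∘ p⊆p∪q _

  ∈-∨ : e ∈ X ∨ e
  ∈-∨ {e = e} {X = X} = ⊆-cl (q⊆p∪q X ⁅ e ⁆ (x∈⁅x⁆ e))

  ∨-least : IsFlat M G → X ⊆ G → e ∈ G → X ∨ e ⊆ G
  ∨-least G-flat X⊆G e∈G = cl-least (∪-least X⊆G (⁅⁆-⊆ e∈G)) G-flat

  ∨-corank : IsCorankFlat M (suc c) X → e ∉ X → IsCorankFlat M c (X ∨ e)
  ∨-corank {c = c} {X = X} {e = e} (X-flat , rX+1+c≡k) e∉X = cl-isFlat _ , (begin
    r (X ∨ e) + c           ≡⟨ cong (_+ c) (trans (r-cl _) (r-∪⁅⁆≡suc (X-flat e e∉X))) ⟩
    suc (r X) + c           ≡⟨ +-suc (r X) c ⟨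
    r X + suc c             ≡⟨ rX+1+c≡k ⟩
    rankM M                 ∎)
    where open ≡-Reasoning

  ∨-≡ : IsCorankFlat M (suc c) X → e ∈ X ∨ a → e ∉ X → X ∨ e ≡ X ∨ a
  ∨-≡ {X = X} {a = a} cX e∈X∨a e∉X = corankFlat-⊆⇒≡ (∨-corank cX e∉X) (∨-corank cX a∉X)
                                        (∨-least (cl-isFlat _) ⊆-∨ e∈X∨a)
    where
    a∉X : a ∉ X
    a∉X a∈X = e∉X (∨-least (proj₁ cX) ⊆-refl a∈X e∈X∨a)

  ∨-common : IsCorankFlat M (suc c) X → e ∈ X ∨ a → e ∈ X ∨ b → e ∉ X → b ∈ X ∨ a
  ∨-common {b = b} cX e∈X∨a e∈X∨b e∉X =
    subst (b ∈_) (trans (sym (∨-≡ cX e∈X∨b e∉X)) (∨-≡ cX e∈X∨a e∉X)) ∈-∨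

  module _ (modular : ∀ A B → IsCorankFlat M 1 A → IsCorankFlat M 1 B → ModularPair M A B) where

    ∩-hyperplanes-corank2 : IsCorankFlat M 1 G → IsCorankFlat M 1 H → G ≢ H → IsCorankFlat M 2 (G ∩ H)
    ∩-hyperplanes-corank2 {G = G} {H = H} cG@(G-flat , rG+1≡k) cH G≢H
      with corankFlat-≢⇒∃∉ cG cH G≢H
    ... | e , e∈H , e∉G =
      ∩-isFlat G-flat (proj₁ cH) ,
      modular-corank 1 1 rG+1≡k (proj₂ cH) (subst (λ u → u + r (G ∩ H) ≡ r G + r H) rG∪H≡k (modular G H cG cH))
      where
      open ≤-Reasoning
      rG∪H≡k : r (G ∪ H) ≡ rankM M
      rG∪H≡k = ≤-antisym (r-mono ⊆⊤) (begin
        rankM M          ≡⟨ trans (sym rG+1≡k) (+-comm (r G) 1) ⟩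
        suc (r G)        ≤⟨ G-flat e e∉G ⟩
        r (G ∪ ⁅ e ⁆)    ≤⟨ r-mono (∪-least (p⊆p∪q H) (q⊆p∪q G H ∘ ⁅⁆-⊆ e∈H)) ⟩
        r (G ∪ H)        ∎)

    ∩-hyperplanes≡∨ : IsCorankFlat M 1 G → IsCorankFlat M 1 H → G ≢ H →
                      IsCorankFlat M 3 Z → Z ⊆ G ∩ H → a ∈ G ∩ H → a ∉ Z → G ∩ H ≡ Z ∨ a
    ∩-hyperplanes≡∨ cG cH G≢H cZ Z⊆G∩H a∈G∩H a∉Z = sym (corankFlat-⊆⇒≡
      (∨-corank cZ a∉Z) (∩-hyperplanes-corank2 cG cH G≢H)
      (∨-least (∩-isFlat (proj₁ cG) (proj₁ cH)) Z⊆G∩H a∈G∩H))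

    ∃-∈-∩-hyperplanes-∖ : IsCorankFlat M 1 G → IsCorankFlat M 1 H → G ≢ H →
                          IsCorankFlat M 3 Z → ∃ λ e → e ∈ G ∩ H ∖ Z
    ∃-∈-∩-hyperplanes-∖ {G = G} {H = H} {Z = Z} cG cH G≢H cZ with ⊆-or-∃∉ (G ∩ H) Z
    ... | inj₁ G∩H⊆Z = ⊥-elim (<⇒≱ (n<1+n 2) (corankFlat-⊆⇒≤ (∩-hyperplanes-corank2 cG cH G≢H) cZ G∩H⊆Z))
    ... | inj₂ witness = witness

    hyperplane-split : IsCorankFlat M 1 G → IsCorankFlat M 1 H → G ≢ H → IsCorankFlat M 3 Z → Z ⊆ G ∩ H →
               a ∈ G ∖ H → G ⊆ H ∪ (Z ∨ a) →
               IsCorankFlat M 2 (G ∩ H) × IsCorankFlat M 2 (Z ∨ a) × G ≡ (G ∩ H) ∪ (Z ∨ a) ×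
               (4 ≤ rankM M → Nonempty ((G ∩ H) ∩ (Z ∨ a)))
    hyperplane-split {G = G} {H = H} cG cH G≢H cZ Z⊆G∩H (a∈G , a∉H) G⊆H∪Z∨a =
      ∩-hyperplanes-corank2 cG cH G≢H ,
      ∨-corank cZ (a∉H ∘ p∩q⊆q G H ∘ Z⊆G∩H) ,
      ⊆-∪⇒≡-∩-∪ G⊆H∪Z∨a (∨-least (proj₁ cG) (p∩q⊆p G H ∘ Z⊆G∩H) a∈G) ,
      λ 4≤k → let (z , z∈Z) = corankFlat-Nonempty cZ 4≤k in z , x∈p∩q⁺ (Z⊆G∩H z∈Z , ⊆-∨ z∈Z)

    module _ {F L Z} (cF : IsCorankFlat M 1 F) (cL : IsCorankFlat M 1 L)
             (cZ : IsCorankFlat M 3 Z) (Z⊆F∩L : Z ⊆ F ∩ L) where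

      transversal : Fin n → Fin n → Subset n
      transversal a b = (Z ∨ a) ∨ b

      private
        Z⊆F : Z ⊆ F
        Z⊆F = p∩q⊆p F L ∘ Z⊆F∩L

        Z⊆L : Z ⊆ L
        Z⊆L = p∩q⊆q F L ∘ Z⊆F∩L

        Z⊆transversal : Z ⊆ transversal a b
        Z⊆transversal = ⊆-∨ ∘ ⊆-∨

      transversal-corank : a ∈ F ∖ L → b ∈ L ∖ F → IsCorankFlat M 1 (transversal a b)
      transversal-corank (a∈F , a∉L) (_ , b∉F) =
        ∨-corank (∨-corank cZ (a∉L ∘ Z⊆L)) (b∉F ∘ ∨-least (proj₁ cF) Z⊆F a∈F)

      transversal-∩-F : a ∈ F ∖ L → b ∈ L ∖ F → transversal a b ∩ F ⊆ Z ∨ a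
      transversal-∩-F {a = a} {b = b} a∈F∖L@(a∈F , a∉L) b∈L∖F@(_ , b∉F) = ⊆-reflexive
        (∩-hyperplanes≡∨ (transversal-corank a∈F∖L b∈L∖F) cF
          (λ T≡F → b∉F (subst (b ∈_) T≡F ∈-∨)) cZ
          (∩-greatest Z⊆transversal Z⊆F) (x∈p∩q⁺ (⊆-∨ ∈-∨ , a∈F)) (a∉L ∘ Z⊆L))

      transversal-∩-L : a ∈ F ∖ L → b ∈ L ∖ F → transversal a b ∩ L ⊆ Z ∨ b
      transversal-∩-L {a = a} {b = b} a∈F∖L@(_ , a∉L) b∈L∖F@(b∈L , b∉F) = ⊆-reflexive
        (∩-hyperplanes≡∨ (transversal-corank a∈F∖L b∈L∖F) cL
          (λ T≡L → a∉L (subst (a ∈_) T≡L (⊆-∨ ∈-∨))) cZ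
          (∩-greatest Z⊆transversal Z⊆L) (x∈p∩q⁺ (∈-∨ , b∈L)) (b∉F ∘ Z⊆F))

      F-collinear-or-L-collinear : F ∪ L ≡ ⊤ → ∀ {a₀ a₁ b₀ b₁} → a₀ ∈ F ∖ L → a₁ ∈ F ∖ L → b₀ ∈ L ∖ F → b₁ ∈ L ∖ F →
             a₁ ∈ Z ∨ a₀ ⊎ b₁ ∈ Z ∨ b₀
      F-collinear-or-L-collinear F∪L≡⊤ {a₀} {a₁} {b₀} {b₁} a₀∈F∖L a₁∈F∖L@(a₁∈F , _) b₀∈L∖F b₁∈L∖F
        with a₁ ∈? transversal a₀ b₀
      ... | yes a₁∈T₀ = inj₁ (transversal-∩-F a₀∈F∖L b₀∈L∖F (x∈p∩q⁺ (a₁∈T₀ , a₁∈F)))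
      ... | no a₁∉T₀
        with ∃-∈-∩-hyperplanes-∖ (transversal-corank a₀∈F∖L b₀∈L∖F) (transversal-corank a₁∈F∖L b₁∈L∖F)
               (λ T₀≡T₁ → a₁∉T₀ (subst (a₁ ∈_) (sym T₀≡T₁) (⊆-∨ ∈-∨))) cZ
      ... | e , e∈T₀∩T₁ , e∉Z with x∈p∩q⁻ _ _ e∈T₀∩T₁ | x∈p∪q⁻ F L (subst (e ∈_) (sym F∪L≡⊤) ∈⊤)
      ... | e∈T₀ , e∈T₁ | inj₁ e∈F = inj₁ (∨-common cZ
        (transversal-∩-F a₀∈F∖L b₀∈L∖F (x∈p∩q⁺ (e∈T₀ , e∈F)))
        (transversal-∩-F a₁∈F∖L b₁∈L∖F (x∈p∩q⁺ (e∈T₁ , e∈F))) e∉Z)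
      ... | e∈T₀ , e∈T₁ | inj₂ e∈L = inj₂ (∨-common cZ
        (transversal-∩-L a₀∈F∖L b₀∈L∖F (x∈p∩q⁺ (e∈T₀ , e∈L)))
        (transversal-∩-L a₁∈F∖L b₁∈L∖F (x∈p∩q⁺ (e∈T₁ , e∈L))) e∉Z)

      F-or-L-covered : F ∪ L ≡ ⊤ → a₀ ∈ F ∖ L → b₀ ∈ L ∖ F → F ⊆ L ∪ (Z ∨ a₀) ⊎ L ⊆ F ∪ (Z ∨ b₀)
      F-or-L-covered {a₀ = a₀} {b₀ = b₀} F∪L≡⊤ a₀∈F∖L b₀∈L∖F with ⊆-or-∃∉ F (L ∪ (Z ∨ a₀))
      ... | inj₁ F⊆L∪Z∨a₀ = inj₁ F⊆L∪Z∨a₀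
      ... | inj₂ (a₁ , a₁∈F , a₁∉L∪Z∨a₀) = inj₂ L⊆F∪Z∨b₀
        where
        L⊆F∪Z∨b₀ : L ⊆ F ∪ (Z ∨ b₀)
        L⊆F∪Z∨b₀ {b} b∈L with b ∈? F
        ... | yes b∈F = p⊆p∪q _ b∈F
        ... | no b∉F with F-collinear-or-L-collinear F∪L≡⊤ a₀∈F∖L (a₁∈F , a₁∉L∪Z∨a₀ ∘ p⊆p∪q _) b₀∈L∖F (b∈L , b∉F)
        ...   | inj₁ a₁∈Z∨a₀ = ⊥-elim (a₁∉L∪Z∨a₀ (q⊆p∪q L _ a₁∈Z∨a₀))
        ...   | inj₂ b∈Z∨b₀ = q⊆p∪q F _ b∈Z∨b₀

      one-hyperplane-splits : F ∪ L ≡ ⊤ → F ≢ L →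
        Σ (Subset n) λ A → Σ (Subset n) λ B →
          IsCorankFlat M 2 A × IsCorankFlat M 2 B × ((F ≡ A ∪ B) ⊎ (L ≡ A ∪ B)) ×
          (4 ≤ rankM M → Nonempty (A ∩ B))
      one-hyperplane-splits F∪L≡⊤ F≢L
        with corankFlat-≢⇒∃∉ cL cF (F≢L ∘ sym) | corankFlat-≢⇒∃∉ cF cL F≢L
      ... | a₀ , a₀∈F∖L | b₀ , b₀∈L∖F with F-or-L-covered F∪L≡⊤ a₀∈F∖L b₀∈L∖F
      ... | inj₁ F⊆L∪Z∨a₀ =
        let cA , cB , F≡A∪B , A∩B-nonempty = hyperplane-split cF cL F≢L cZ Z⊆F∩L a₀∈F∖L F⊆L∪Z∨a₀
        in F ∩ L , Z ∨ a₀ , cA , cB , inj₁ F≡A∪B , A∩B-nonempty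
      ... | inj₂ L⊆F∪Z∨b₀ =
        let cA , cB , L≡A∪B , A∩B-nonempty = hyperplane-split cL cF (F≢L ∘ sym) cZ (∩-greatest Z⊆L Z⊆F) b₀∈L∖F L⊆F∪Z∨b₀
        in L ∩ F , Z ∨ b₀ , cA , cB , inj₂ L≡A∪B , A∩B-nonempty

open MatroidFlats

proposition3p2 : ∀ {n} (M : Matroid n) → Loopless M → Hypermodular M →
    (F L : Subset n) → IsCorankFlat M 1 F → IsCorankFlat M 1 L → ¬ (F ≡ L) →
    ((F ∪ L) ⊂ ⊤) ⊎
    (((F ∪ L) ≡ ⊤) ×
      Σ (Subset n) (λ A → Σ (Subset n) (λ B →
        IsCorankFlat M 2 A × IsCorankFlat M 2 B ×
        ((F ≡ (A ∪ B)) ⊎ (L ≡ (A ∪ B))) ×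
        (4 ≤ rankM M → Nonempty (A ∩ B)))))
proposition3p2 M _ (3≤k , modular) F L cF cL F≢L with ⊆-or-∃∉ ⊤ (F ∪ L)
... | inj₂ (e , _ , e∉F∪L) = inj₁ (⊆⊤ , e , ∈⊤ , e∉F∪L)
... | inj₁ ⊤⊆F∪L =
  let Z , cZ , Z⊆F∩L = ∃-corankFlat-⊆ M (∩-hyperplanes-corank2 M modular cF cL F≢L) (n≤1+n 2) 3≤k
  in inj₂ (F∪L≡⊤ , one-hyperplane-splits M modular cF cL cZ Z⊆F∩L F∪L≡⊤ F≢L)
  where
  F∪L≡⊤ : F ∪ L ≡ ⊤
  F∪L≡⊤ = ⊆-antisym ⊆⊤ ⊤⊆F∪L
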